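{- Let $q$ be a prime power and $n,r$ positive integers. Let $(U_1,\ldots,U_r)$ and $(W_1,\ldots,W_r)$ be two families each consisting of $r$ distinct $\mathbb{F}_q$-subspaces of $\mathbb{F}_{q^n}$, all of dimension greater than one. Suppose that $\dim_{\mathbb{F}_q}(U_i\cap\alpha U_j)\leq 1$ and $\dim_{\mathbb{F}_q}(W_i\cap\alpha W_j)\leq 1$ for every $\alpha\in\mathbb{F}_{q^n}$ and all $i,j\in\{1,\ldots,r\}$ with $i\neq j$. Then $\{U_1,\ldots,U_r\}$ and $\{W_1,\ldots,W_r\}$ are equivalent if and only if there exist a permutation $\sigma\in S_r$, elements $\lambda_1,\ldots,\lambda_r\in\mathbb{F}_{q^n}^*$ and $\rho\in\mathrm{Aut}(\mathbb{F}_{q^n})$ such that $W_i=\lambda_iU_{\sigma(i)}^\rho$ for every $i\in\{1,\ldots,r\}$. In particular, in that case $\dim_{\mathbb{F}_q}(W_i)=\dim_{\mathbb{F}_q}(U_{\sigma(i)})$ for every $i$.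
   Context: $\mathrm{\Gamma L}(r,q^n)=\mathrm{GL}(r,q^n)\rtimes\mathrm{Aut}(\mathbb{F}_{q^n})$ acts on $\mathbb{F}_{q^n}^r$ by semilinear maps. Two families $\{U_1,\ldots,U_r\}$ and $\{W_1,\ldots,W_r\}$ of $r$ distinct $\mathbb{F}_q$-subspaces of $\mathbb{F}_{q^n}$ are called equivalent if there exists $\varphi\in\mathrm{\Gamma L}(r,q^n)$ with $\varphi(U_1\times\cdots\times U_r)=W_1\times\cdots\times W_r$. For $\rho\in\mathrm{Aut}(\mathbb{F}_{q^n})$, $U^\rho=\{u^\rho: u\in U\}$; $\alpha U=\{\alpha u:u\in U\}$. -}

module Defs where

open import Level using (0ℓ)
open import Data.Nat as ℕ using (ℕ; _≤_; _<_)
open import Data.Nat.Primality using (Prime)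
open import Data.Fin using (Fin; _≟_)
open import Data.Fin.Permutation using (Permutation′; _⟨$⟩ʳ_)
open import Data.Product using (Σ; ∃; ∃₂; _×_; _,_)
open import Data.Bool using (if_then_else_)
open import Relation.Nullary using (¬_; does)
open import Relation.Unary using (Pred; _∩_; _≐_)
open import Relation.Binary.PropositionalEquality using (_≡_; _≢_) renaming (setoid to ≡-setoid)
open import Algebra.Bundles using (CommutativeRing; RawRing)
open import Algebra.Morphism.Structures using (module RingMorphisms)
open import Function.Bundles using (Inverse)

IsPrimePower : ℕ → Set
IsPrimePower q = ∃₂ λ p k → Prime p × 1 ≤ k × q ≡ p ℕ.^ k

record IsFiniteField (R : CommutativeRing 0ℓ 0ℓ) (m : ℕ) : Set where
  open CommutativeRing R
  field
    1≉0         : ¬ (1# ≈ 0#)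
    inverse     : ∀ x → ¬ (x ≈ 0#) → ∃ λ y → x * y ≈ 1#
    enumeration : Inverse (≡-setoid (Fin m)) setoid

module Over (R : CommutativeRing 0ℓ 0ℓ) (q : ℕ) where
  open CommutativeRing R
  open import Algebra.Definitions.RawSemiring (RawRing.rawSemiring rawRing) using (sum) renaming (_^_ to _^ᴿ_)
  open RingMorphisms rawRing rawRing using (IsRingIsomorphism)

  Fq : Pred Carrier 0ℓ
  Fq x = x ^ᴿ q ≈ x

  record IsSubspace (U : Pred Carrier 0ℓ) : Set where
    field
      resp : ∀ {x y} → x ≈ y → U x → U y
      has0 : U 0#
      add  : ∀ {x y} → U x → U y → U (x + y)
      smul : ∀ {a x} → Fq a → U x → U (a * x)

  lincomb : ∀ {d} → (Fin d → Carrier) → (Fin d → Carrier) → Carrier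
  lincomb a b = sum (λ i → a i * b i)

  InSpan : ∀ {d} → (Fin d → Carrier) → Carrier → Set
  InSpan {d} b x = ∃ λ (a : Fin d → Carrier) → (∀ i → Fq (a i)) × x ≈ lincomb a b

  LinIndep : ∀ {d} → (Fin d → Carrier) → Set
  LinIndep {d} b = (a : Fin d → Carrier) → (∀ i → Fq (a i)) →
                   lincomb a b ≈ 0# → ∀ i → a i ≈ 0#

  HasDim : Pred Carrier 0ℓ → ℕ → Set
  HasDim U d = ∃ λ (b : Fin d → Carrier) →
    (∀ i → U (b i)) × LinIndep b × (∀ x → U x → InSpan b x)

  _·_ : Carrier → Pred Carrier 0ℓ → Pred Carrier 0ℓ
  (α · U) x = ∃ λ u → U u × x ≈ α * u

  _^[_] : Pred Carrier 0ℓ → (Carrier → Carrier) → Pred Carrier 0ℓ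
  (U ^[ ρ ]) x = ∃ λ u → U u × x ≈ ρ u

  IsAut : (Carrier → Carrier) → Set
  IsAut ρ = IsRingIsomorphism ρ

  Matrix : ℕ → Set
  Matrix r = Fin r → Fin r → Carrier

  _⊗_ : ∀ {r} → Matrix r → Matrix r → Matrix r
  (A ⊗ B) i k = sum (λ j → A i j * B j k)

  Id : ∀ {r} → Matrix r
  Id i j = if does (i ≟ j) then 1# else 0#

  Invertible : ∀ {r} → Matrix r → Set
  Invertible {r} A = ∃ λ (B : Matrix r) →
    (∀ i k → (A ⊗ B) i k ≈ Id i k) × (∀ i k → (B ⊗ A) i k ≈ Id i k)

  -- the semilinear map v ↦ A v^ρ of F_{q^n}^r given by (A, ρ) ∈ ΓL(r, q^n)
  act : ∀ {r} → Matrix r → (Carrier → Carrier) → (Fin r → Carrier) → (Fin r → Carrier)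
  act A ρ v i = sum (λ j → A i j * ρ (v j))

  Prod : ∀ {r} → (Fin r → Pred Carrier 0ℓ) → Pred (Fin r → Carrier) 0ℓ
  Prod U v = ∀ i → U i (v i)

  Image : ∀ {r} → Matrix r → (Carrier → Carrier) →
          Pred (Fin r → Carrier) 0ℓ → Pred (Fin r → Carrier) 0ℓ
  Image A ρ S w = ∃ λ v → S v × (∀ i → act A ρ v i ≈ w i)

  Equivalent : ∀ {r} → (Fin r → Pred Carrier 0ℓ) → (Fin r → Pred Carrier 0ℓ) → Set
  Equivalent {r} U W = ∃₂ λ (A : Matrix r) (ρ : Carrier → Carrier) →
    Invertible A × IsAut ρ × (Image A ρ (Prod U) ≐ Prod W)

  Distinct : ∀ {r} → (Fin r → Pred Carrier 0ℓ) → Set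
  Distinct U = ∀ i j → i ≢ j → ¬ (U i ≐ U j)

  Relates : ∀ {r} → (Fin r → Pred Carrier 0ℓ) → (Fin r → Pred Carrier 0ℓ) →
            Permutation′ r → (Fin r → Carrier) → (Carrier → Carrier) → Set
  Relates U W σ λs ρ = IsAut ρ × (∀ i → ¬ (λs i ≈ 0#)) ×
    (∀ i → W i ≐ (λs i · (U (σ ⟨$⟩ʳ i) ^[ ρ ])))

  record Admissible {r} (U : Fin r → Pred Carrier 0ℓ) : Set where
    field
      subspace : ∀ i → IsSubspace (U i)
      distinct : Distinct U
      dim>1    : ∀ i → ∃ λ d → 1 < d × HasDim (U i) d
      scattered : ∀ (α : Carrier) i j → i ≢ j →
                  ∃ λ d → d ≤ 1 × HasDim (U i ∩ (α · U j)) d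

-- An equivalence is a pair (A, ρ) acting by v ↦ A v^ρ. Feeding in vectors with a single nonzero
-- coordinate u ∈ U_j shows A_ij ρ(U_j) ⊆ W_i for every i. If column j of A had two nonzero entries
-- A_ij, A_lj with i ≠ l, then A_ij ρ(U_j) would lie in W_i ∩ (A_ij / A_lj) W_l, of dimension ≤ 1,
-- although ρ(U_j) contains two F_q-independent vectors because dim U_j > 1. So every column has a
-- single nonzero entry, invertibility makes A monomial, and A v^ρ = (λ_i v_{σ(i)}^ρ)_i yields
-- W_i = λ_i U_{σ(i)}^ρ. Conversely monomial matrices realise such relations, and u ↦ λ u^ρ preserves
-- F_q-dimension because ρ maps F_q = {x | x^q = x} onto itself. The prime power hypothesis is only
-- needed to see that F_q is closed under negation.

module Submission where

open import Defs
open import Level using (0ℓ)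
open import Algebra.Bundles using (CommutativeRing; RawRing)
open import Algebra.Morphism.Structures using (module RingMorphisms)
open import Data.Bool using (true; false; if_then_else_)
open import Data.Fin using (Fin; zero; suc; _≟_)
open import Data.Fin.Permutation using (Permutation′; _⟨$⟩ʳ_; _⟨$⟩ˡ_; permutation; flip; inverseˡ; inverseʳ)
open import Data.Fin.Properties using (punchInᵢ≢i; ¬∀⟶∃¬)
open import Data.Nat as ℕ using (ℕ; zero; suc; _≤_; _^_)
import Data.Nat.Properties as ℕP
open import Data.Nat.Divisibility using (_∣_; _∣0; ∣-refl; ∣m∣n⇒∣m+n; ∣1⇒≡1)
open import Data.Nat.Primality using (Prime; ¬prime[1]; prime[2]; euclidsLemma; prime⇒irreducible; prime⇒nonZero)
open import Data.Product using (∃; ∃₂; _×_; _,_; proj₁; proj₂)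
open import Data.Sum using (_⊎_; inj₁; inj₂; [_,_]′)
open import Data.Vec.Functional using (removeAt)
open import Function using (_∘_; id)
open import Function.Bundles using (_⇔_; Inverse; mk⇔)
open import Relation.Binary using (Decidable)
open import Relation.Binary.PropositionalEquality as ≡ using (_≡_; _≢_)
open import Relation.Nullary using (¬_; does; yes; no)
open import Relation.Nullary.Decidable using (map′; dec-true; dec-false; decidable-stable)
open import Relation.Nullary.Negation using (contradiction)
open import Relation.Unary using (Pred; _⊆_; _≐_; _∩_)
open import Relation.Unary.Properties using (≐-sym)

prime∣prime^⇒≡ : ∀ {d p} k → Prime d → Prime p → d ∣ p ^ k → d ≡ p
prime∣prime^⇒≡ zero d-prime _ d∣1 = contradiction (≡.subst Prime (∣1⇒≡1 d∣1) d-prime) ¬prime[1]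
prime∣prime^⇒≡ {p = p} (suc k) d-prime p-prime d∣p^[1+k] with euclidsLemma p (p ^ k) d-prime d∣p^[1+k]
... | inj₁ d∣p = [ (λ d≡1 → contradiction (≡.subst Prime d≡1 d-prime) ¬prime[1]) , id ]′ (prime⇒irreducible p-prime d∣p)
... | inj₂ d∣p^k = prime∣prime^⇒≡ k d-prime p-prime d∣p^k

module RingProperties (R : CommutativeRing 0ℓ 0ℓ) where
  open CommutativeRing R
  open import Algebra.Properties.Semiring.Sum semiring public
    using (sum-cong-≋; sum-replicate; sum-replicate-zero; sum-remove; sum-permute; ∑-distrib-+; *-distribˡ-sum)
  open import Algebra.Properties.Semiring.Mult semiring using (×1-homo-*) renaming (_×_ to _×ᴿ_)
  open import Algebra.Properties.Ring ring using (-1*x≈-x)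
  open import Algebra.Properties.Group +-group using (⁻¹-involutive)
  open import Algebra.Definitions.RawSemiring (RawRing.rawSemiring rawRing) using (sum) renaming (_^_ to _^ᴿ_)

  sum-zero : ∀ {d} {f : Fin d → Carrier} → (∀ i → f i ≈ 0#) → sum f ≈ 0#
  sum-zero {d} f≈0 = trans (sum-cong-≋ f≈0) (sum-replicate-zero d)

  sum-single : ∀ {d} {f : Fin d → Carrier} j → (∀ i → i ≢ j → f i ≈ 0#) → sum f ≈ f j
  sum-single {suc d} {f} j f≈0 = begin
    sum f                        ≈⟨ sum-remove {i = j} f ⟩
    f j + sum (removeAt f j)     ≈⟨ +-congˡ (sum-zero (λ i → f≈0 _ (punchInᵢ≢i j i))) ⟩
    f j + 0#                     ≈⟨ +-identityʳ (f j) ⟩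
    f j                          ∎
    where open import Relation.Binary.Reasoning.Setoid setoid

  sum-homo : (h : Carrier → Carrier) → h 0# ≈ 0# → (∀ x y → h (x + y) ≈ h x + h y) →
             ∀ {d} (f : Fin d → Carrier) → h (sum f) ≈ sum (h ∘ f)
  sum-homo h h0 h+ {zero} f = h0
  sum-homo h h0 h+ {suc d} f = trans (h+ _ _) (+-congˡ (sum-homo h h0 h+ (f ∘ suc)))

  single : ∀ {r} → Fin r → Carrier → Fin r → Carrier
  single k x j = if does (k ≟ j) then x else 0#

  single-≡ : ∀ {r} (k : Fin r) x → single k x k ≡ x
  single-≡ k x rewrite dec-true (k ≟ k) ≡.refl = ≡.refl

  single-≢ : ∀ {r} {k j : Fin r} x → k ≢ j → single k x j ≡ 0#
  single-≢ {k = k} {j} x k≢j rewrite dec-false (k ≟ j) k≢j = ≡.refl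

  *-single : ∀ {r} (k j : Fin r) x y → x * single k y j ≈ single k (x * y) j
  *-single k j x y with does (k ≟ j)
  ... | true  = refl
  ... | false = zeroʳ x

  single-cong : ∀ {r} (k j : Fin r) {x y} → x ≈ y → single k x j ≈ single k y j
  single-cong k j x≈y with does (k ≟ j)
  ... | true  = x≈y
  ... | false = refl

  -1^≈-1⊎2∣ : ∀ k → (- 1#) ^ᴿ k ≈ - 1# ⊎ 2 ∣ k
  -1^≈-1⊎2∣ zero = inj₂ (2 ∣0)
  -1^≈-1⊎2∣ (suc zero) = inj₁ (*-identityʳ (- 1#))
  -1^≈-1⊎2∣ (suc (suc k)) with -1^≈-1⊎2∣ k
  ... | inj₁ -1^k≈-1 = inj₁ (trans (sym (*-assoc _ _ _)) (trans (*-congʳ -1*-1≈1) (trans (*-identityˡ _) -1^k≈-1)))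
    where -1*-1≈1 = trans (-1*x≈-x (- 1#)) (⁻¹-involutive 1#)
  ... | inj₂ 2∣k = inj₂ (∣m∣n⇒∣m+n ∣-refl 2∣k)

  ^-×1 : ∀ p e → (p ℕ.^ e) ×ᴿ 1# ≈ (p ×ᴿ 1#) ^ᴿ e
  ^-×1 p zero = +-identityʳ 1#
  ^-×1 p (suc e) = trans (×1-homo-* p (p ℕ.^ e)) (*-congˡ (^-×1 p e))

module FiniteFieldProperties (R : CommutativeRing 0ℓ 0ℓ) {m : ℕ} (F : IsFiniteField R m) where
  open CommutativeRing R
  open IsFiniteField F
  open RingProperties R
  open Inverse enumeration using (to; from; to-cong; from-cong; strictlyInverseˡ; strictlyInverseʳ)
  open import Algebra.Definitions.RawSemiring (RawRing.rawSemiring rawRing) using (sum) renaming (_^_ to _^ᴿ_)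
  open import Algebra.Properties.Semiring.Mult semiring using () renaming (_×_ to _×ᴿ_)
  open import Algebra.Properties.Group +-group using (identityʳ-unique)
  open import Relation.Binary.Reasoning.Setoid setoid

  _≈?_ : Decidable _≈_
  x ≈? y = map′ (λ e → trans (sym (strictlyInverseˡ x)) (trans (to-cong e) (strictlyInverseˡ y)))
                from-cong (from x ≟ from y)

  x≉0∧xy≈0⇒y≈0 : ∀ {x y} → x ≉ 0# → x * y ≈ 0# → y ≈ 0#
  x≉0∧xy≈0⇒y≈0 {x} {y} x≉0 xy≈0 with inverse x x≉0
  ... | x⁻¹ , xx⁻¹≈1 = begin
    y              ≈⟨ *-identityˡ y ⟨
    1# * y         ≈⟨ *-congʳ (trans (sym xx⁻¹≈1) (*-comm x x⁻¹)) ⟩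
    (x⁻¹ * x) * y  ≈⟨ *-assoc x⁻¹ x y ⟩
    x⁻¹ * (x * y)  ≈⟨ *-congˡ xy≈0 ⟩
    x⁻¹ * 0#       ≈⟨ zeroʳ x⁻¹ ⟩
    0#             ∎

  x^k≈0⇒x≈0 : ∀ x k → x ^ᴿ k ≈ 0# → x ≈ 0#
  x^k≈0⇒x≈0 x zero 1≈0 = contradiction 1≈0 1≉0
  x^k≈0⇒x≈0 x (suc k) x^[1+k]≈0 with x ≈? 0#
  ... | yes x≈0 = x≈0
  ... | no  x≉0 = x^k≈0⇒x≈0 x k (x≉0∧xy≈0⇒y≈0 x≉0 x^[1+k]≈0)

  -- Translation by 1 permutes the field, so the sum of all elements is unchanged by adding m × 1.
  size×1≈0 : m ×ᴿ 1# ≈ 0#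
  size×1≈0 = identityʳ-unique (sum to) (m ×ᴿ 1#) (sym (begin
    sum to                         ≈⟨ sum-permute to (permutation (shift 1#) (shift (- 1#)) (shift-shift (-‿inverseˡ 1#)) (shift-shift (-‿inverseʳ 1#))) ⟩
    sum (λ i → to (shift 1# i))    ≈⟨ sum-cong-≋ {m} (λ i → strictlyInverseˡ (to i + 1#)) ⟩
    sum (λ i → to i + 1#)          ≈⟨ ∑-distrib-+ {m} to (λ _ → 1#) ⟩
    sum to + sum {m} (λ _ → 1#)    ≈⟨ +-congˡ (sum-replicate m) ⟩
    sum to + m ×ᴿ 1#               ∎))
    where
    shift : Carrier → Fin m → Fin m
    shift a i = from (to i + a)
    shift-shift : ∀ {a b} → b + a ≈ 0# → ∀ i → shift a (shift b i) ≡ i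
    shift-shift {a} {b} b+a≈0 i = ≡.trans (from-cong (begin
      to (from (to i + b)) + a  ≈⟨ +-congʳ (strictlyInverseˡ _) ⟩
      (to i + b) + a           ≈⟨ +-assoc _ _ _ ⟩
      to i + (b + a)           ≈⟨ +-congˡ b+a≈0 ⟩
      to i + 0#                ≈⟨ +-identityʳ _ ⟩
      to i                     ∎)) (strictlyInverseʳ i)

  size≡p^e⇒p×1≈0 : ∀ p e → m ≡ p ℕ.^ e → p ×ᴿ 1# ≈ 0#
  size≡p^e⇒p×1≈0 p e ≡.refl = x^k≈0⇒x≈0 (p ×ᴿ 1#) e (trans (sym (^-×1 p e)) size×1≈0)

module Semilinear (R : CommutativeRing 0ℓ 0ℓ) {m : ℕ} (F : IsFiniteField R m) (q : ℕ) where
  open CommutativeRing R hiding (zero)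
  open IsFiniteField F using (1≉0; inverse)
  open RingProperties R
  open FiniteFieldProperties R F
  open Over R q
  open RingMorphisms rawRing rawRing using (IsRingIsomorphism)
  open import Algebra.Definitions.RawSemiring (RawRing.rawSemiring rawRing) using (sum) renaming (_^_ to _^ᴿ_)
  open import Algebra.Properties.CommutativeSemiring.Exp commutativeSemiring using (^-congˡ; ^-distrib-*)
  open import Algebra.Properties.Ring ring using (-1*x≈-x; -‿distribˡ-*)
  open import Algebra.Properties.Group +-group using (⁻¹-involutive; ε⁻¹≈ε)
  open import Algebra.Properties.CommutativeSemigroup *-commutativeSemigroup using (x∙yz≈y∙xz)
  open import Relation.Binary.Reasoning.Setoid setoid

  Fq-resp : ∀ {a b} → a ≈ b → Fq a → Fq b
  Fq-resp a≈b a^q≈a = trans (^-congˡ q (sym a≈b)) (trans a^q≈a a≈b)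

  Fq-1 : Fq 1#
  Fq-1 = 1^k≈1 q
    where
    1^k≈1 : ∀ k → 1# ^ᴿ k ≈ 1#
    1^k≈1 zero = refl
    1^k≈1 (suc k) = trans (*-identityˡ _) (1^k≈1 k)

  Fq-* : ∀ {a b} → Fq a → Fq b → Fq (a * b)
  Fq-* a^q≈a b^q≈b = trans (^-distrib-* _ _ q) (*-cong a^q≈a b^q≈b)

  ∈-·^⁺ : ∀ {X ρ λ' u z} → X u → z ≈ λ' * ρ u → (λ' · (X ^[ ρ ])) z
  ∈-·^⁺ {ρ = ρ} {u = u} u∈X z≈λρu = ρ u , (u , u∈X , refl) , z≈λρu

  ∈-·^⁻ : ∀ {X ρ λ' z} → (λ' · (X ^[ ρ ])) z → ∃ λ u → X u × z ≈ λ' * ρ u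
  ∈-·^⁻ (u′ , (u , u∈X , u′≈ρu) , z≈λu′) = u , u∈X , trans z≈λu′ (*-congˡ u′≈ρu)

  module Automorphism {ρ : Carrier → Carrier} (ρ-aut : IsAut ρ) where
    open IsRingIsomorphism ρ-aut public using (⟦⟧-cong; 0#-homo; 1#-homo; +-homo; *-homo; injective)
    open IsRingIsomorphism ρ-aut using (surjective)

    ρ⁻¹ : Carrier → Carrier
    ρ⁻¹ a = proj₁ (surjective a)

    ρ∘ρ⁻¹ : ∀ a → ρ (ρ⁻¹ a) ≈ a
    ρ∘ρ⁻¹ a = proj₂ (surjective a) refl

    ρ≈0⇒≈0 : ∀ {x} → ρ x ≈ 0# → x ≈ 0#
    ρ≈0⇒≈0 ρx≈0 = injective (trans ρx≈0 (sym 0#-homo))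

    ρ⁻¹≈0⇒≈0 : ∀ {a} → ρ⁻¹ a ≈ 0# → a ≈ 0#
    ρ⁻¹≈0⇒≈0 {a} ρ⁻¹a≈0 = trans (sym (ρ∘ρ⁻¹ a)) (trans (⟦⟧-cong ρ⁻¹a≈0) 0#-homo)

    ρ-^ : ∀ x k → ρ (x ^ᴿ k) ≈ ρ x ^ᴿ k
    ρ-^ x zero = 1#-homo
    ρ-^ x (suc k) = trans (*-homo _ _) (*-congˡ (ρ-^ x k))

    Fq-ρ : ∀ {a} → Fq a → Fq (ρ a)
    Fq-ρ {a} a^q≈a = trans (sym (ρ-^ a q)) (⟦⟧-cong a^q≈a)

    Fq-ρ⁻¹ : ∀ {a} → Fq a → Fq (ρ⁻¹ a)
    Fq-ρ⁻¹ {a} a^q≈a = injective (begin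
      ρ (ρ⁻¹ a ^ᴿ q)   ≈⟨ ρ-^ (ρ⁻¹ a) q ⟩
      ρ (ρ⁻¹ a) ^ᴿ q   ≈⟨ ^-congˡ q (ρ∘ρ⁻¹ a) ⟩
      a ^ᴿ q           ≈⟨ a^q≈a ⟩
      a                ≈⟨ ρ∘ρ⁻¹ a ⟨
      ρ (ρ⁻¹ a)        ∎)

    semilinear-lincomb : ∀ {d} λ' (c b : Fin d → Carrier) →
                         λ' * ρ (lincomb c b) ≈ lincomb (ρ ∘ c) (λ k → λ' * ρ (b k))
    semilinear-lincomb {d} λ' c b = begin
      λ' * ρ (sum (λ k → c k * b k))        ≈⟨ *-congˡ (sum-homo ρ 0#-homo +-homo (λ k → c k * b k)) ⟩
      λ' * sum (λ k → ρ (c k * b k))        ≈⟨ *-distribˡ-sum λ' (λ k → ρ (c k * b k)) ⟩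
      sum (λ k → λ' * ρ (c k * b k))        ≈⟨ sum-cong-≋ {d} (λ k → trans (*-congˡ (*-homo _ _)) (x∙yz≈y∙xz λ' _ _)) ⟩
      sum (λ k → ρ (c k) * (λ' * ρ (b k)))  ∎

    semilinear-image-dim : ∀ {U d λ'} → λ' ≉ 0# → HasDim U d → HasDim (λ' · (U ^[ ρ ])) d
    semilinear-image-dim {U} {d} {λ'} λ'≉0 (b , b∈U , b-indep , b-span) = b′ , b′∈ , b′-indep , b′-span
      where
      b′ : Fin d → Carrier
      b′ k = λ' * ρ (b k)
      b′∈ : ∀ k → (λ' · (U ^[ ρ ])) (b′ k)
      b′∈ k = ∈-·^⁺ (b∈U k) refl
      b′-indep : LinIndep b′
      b′-indep a a∈Fq lincomb≈0 k = begin
        a k              ≈⟨ ρ∘ρ⁻¹ (a k) ⟨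
        ρ (ρ⁻¹ (a k))    ≈⟨ ⟦⟧-cong (b-indep (ρ⁻¹ ∘ a) (Fq-ρ⁻¹ ∘ a∈Fq) preimage≈0 k) ⟩
        ρ 0#             ≈⟨ 0#-homo ⟩
        0#               ∎
        where
        preimage≈0 : lincomb (ρ⁻¹ ∘ a) b ≈ 0#
        preimage≈0 = ρ≈0⇒≈0 (x≉0∧xy≈0⇒y≈0 λ'≉0 (begin
          λ' * ρ (lincomb (ρ⁻¹ ∘ a) b)  ≈⟨ semilinear-lincomb λ' (ρ⁻¹ ∘ a) b ⟩
          lincomb (ρ ∘ ρ⁻¹ ∘ a) b′      ≈⟨ sum-cong-≋ {d} (λ k → *-congʳ (ρ∘ρ⁻¹ (a k))) ⟩
          lincomb a b′                  ≈⟨ lincomb≈0 ⟩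
          0#                            ∎))
      b′-span : ∀ x → (λ' · (U ^[ ρ ])) x → InSpan b′ x
      b′-span x x∈ with ∈-·^⁻ x∈
      ... | u , u∈U , x≈λρu with b-span u u∈U
      ... | c , c∈Fq , u≈cb = ρ ∘ c , Fq-ρ ∘ c∈Fq , (begin
        x                      ≈⟨ x≈λρu ⟩
        λ' * ρ u               ≈⟨ *-congˡ (⟦⟧-cong u≈cb) ⟩
        λ' * ρ (lincomb c b)   ≈⟨ semilinear-lincomb λ' c b ⟩
        lincomb (ρ ∘ c) b′     ∎)

  HasDim-resp-≐ : ∀ {X Y d} → X ≐ Y → HasDim X d → HasDim Y d
  HasDim-resp-≐ (X⊆Y , Y⊆X) (b , b∈X , b-indep , b-span) = b , X⊆Y ∘ b∈X , b-indep , λ x → b-span x ∘ Y⊆X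

  Independent₂ : Carrier → Carrier → Set
  Independent₂ x y = ∀ a c → Fq a → Fq c → a * x + c * y ≈ 0# → a ≈ 0# × c ≈ 0#

  independent₂-scale : ∀ {λ' x y} → λ' ≉ 0# → Independent₂ x y → Independent₂ (λ' * x) (λ' * y)
  independent₂-scale {λ'} {x} {y} λ'≉0 x⊥y a c a∈Fq c∈Fq rel = x⊥y a c a∈Fq c∈Fq (x≉0∧xy≈0⇒y≈0 λ'≉0 (begin
    λ' * (a * x + c * y)             ≈⟨ distribˡ λ' _ _ ⟩
    λ' * (a * x) + λ' * (c * y)      ≈⟨ +-cong (x∙yz≈y∙xz λ' a x) (x∙yz≈y∙xz λ' c y) ⟩
    a * (λ' * x) + c * (λ' * y)      ≈⟨ rel ⟩
    0#                               ∎))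

  independent₂-ρ : ∀ {ρ} → IsAut ρ → ∀ {x y} → Independent₂ x y → Independent₂ (ρ x) (ρ y)
  independent₂-ρ {ρ} ρ-aut {x} {y} x⊥y a c a∈Fq c∈Fq rel =
    ρ⁻¹≈0⇒≈0 (proj₁ preimage-trivial) , ρ⁻¹≈0⇒≈0 (proj₂ preimage-trivial)
    where
    open Automorphism ρ-aut
    preimage-trivial : ρ⁻¹ a ≈ 0# × ρ⁻¹ c ≈ 0#
    preimage-trivial = x⊥y (ρ⁻¹ a) (ρ⁻¹ c) (Fq-ρ⁻¹ a∈Fq) (Fq-ρ⁻¹ c∈Fq) (ρ≈0⇒≈0 (begin
      ρ (ρ⁻¹ a * x + ρ⁻¹ c * y)              ≈⟨ +-homo _ _ ⟩
      ρ (ρ⁻¹ a * x) + ρ (ρ⁻¹ c * y)          ≈⟨ +-cong (*-homo _ _) (*-homo _ _) ⟩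
      ρ (ρ⁻¹ a) * ρ x + ρ (ρ⁻¹ c) * ρ y      ≈⟨ +-cong (*-congʳ (ρ∘ρ⁻¹ a)) (*-congʳ (ρ∘ρ⁻¹ c)) ⟩
      a * ρ x + c * ρ y                      ≈⟨ rel ⟩
      0#                                     ∎))

  ColumnSparse : ∀ {r} → Matrix r → Set
  ColumnSparse A = ∀ {i l j} → A i j ≉ 0# → A l j ≉ 0# → i ≡ l

  SupportedOn : ∀ {r} → Matrix r → Permutation′ r → Set
  SupportedOn A σ = ∀ i j → j ≢ σ ⟨$⟩ʳ i → A i j ≈ 0#

  supported-row-sum : ∀ {r} {A : Matrix r} {σ} → SupportedOn A σ → ∀ i (f : Fin r → Carrier) →
                      sum (λ j → A i j * f j) ≈ A i (σ ⟨$⟩ʳ i) * f (σ ⟨$⟩ʳ i)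
  supported-row-sum {σ = σ} A-supp i f = sum-single _ (λ j j≢σi → trans (*-congʳ (A-supp i j j≢σi)) (zeroˡ _))

  monomial : ∀ {r} → Permutation′ r → (Fin r → Carrier) → Matrix r
  monomial σ λs i = single (σ ⟨$⟩ʳ i) (λs i)

  monomial-supported : ∀ {r} (σ : Permutation′ r) λs → SupportedOn (monomial σ λs) σ
  monomial-supported σ λs i j j≢σi = reflexive (single-≢ (λs i) (j≢σi ∘ ≡.sym))

  monomial-invertible : ∀ {r} (σ : Permutation′ r) {λs} → (∀ i → λs i ≉ 0#) → Invertible (monomial σ λs)
  monomial-invertible {r} σ {λs} λs≉0 = B , A⊗B≈Id , B⊗A≈Id
    where
    A = monomial σ λs
    λs⁻¹ : Fin r → Carrier
    λs⁻¹ i = proj₁ (inverse (λs i) (λs≉0 i))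
    λs*λs⁻¹≈1 : ∀ i → λs i * λs⁻¹ i ≈ 1#
    λs*λs⁻¹≈1 i = proj₂ (inverse (λs i) (λs≉0 i))
    B = monomial (flip σ) (λs⁻¹ ∘ (σ ⟨$⟩ˡ_))
    scaled-single≈Id : ∀ {x y} k j → x * y ≈ 1# → x * single k y j ≈ Id k j
    scaled-single≈Id k j xy≈1 = trans (*-single k j _ _) (single-cong k j xy≈1)
    A⊗B≈Id : ∀ i k → (A ⊗ B) i k ≈ Id i k
    A⊗B≈Id i k = begin
      (A ⊗ B) i k                            ≈⟨ supported-row-sum {σ = σ} (monomial-supported σ λs) i (λ j → B j k) ⟩
      A i (σ ⟨$⟩ʳ i) * B (σ ⟨$⟩ʳ i) k        ≡⟨ ≡.cong₂ _*_ (single-≡ (σ ⟨$⟩ʳ i) (λs i)) (≡.cong (λ l → single l (λs⁻¹ l) k) (inverseˡ σ)) ⟩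
      λs i * single i (λs⁻¹ i) k             ≈⟨ scaled-single≈Id i k (λs*λs⁻¹≈1 i) ⟩
      Id i k                                 ∎
    B⊗A≈Id : ∀ j k → (B ⊗ A) j k ≈ Id j k
    B⊗A≈Id j k = begin
      (B ⊗ A) j k                            ≈⟨ supported-row-sum {σ = flip σ} (monomial-supported (flip σ) (λs⁻¹ ∘ (σ ⟨$⟩ˡ_))) j (λ i → A i k) ⟩
      B j (σ ⟨$⟩ˡ j) * A (σ ⟨$⟩ˡ j) k        ≡⟨ ≡.cong₂ _*_ (single-≡ (σ ⟨$⟩ˡ j) (λs⁻¹ (σ ⟨$⟩ˡ j))) (≡.cong (λ l → single l (λs (σ ⟨$⟩ˡ j)) k) (inverseʳ σ)) ⟩
      λs⁻¹ (σ ⟨$⟩ˡ j) * single j (λs (σ ⟨$⟩ˡ j)) k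
                                             ≈⟨ scaled-single≈Id j k (trans (*-comm _ _) (λs*λs⁻¹≈1 _)) ⟩
      Id j k                                 ∎

  invertible∧sparse⇒monomial : ∀ {r} {A : Matrix r} → Invertible A → ColumnSparse A →
                               ∃ λ σ → SupportedOn A σ × (∀ i → A i (σ ⟨$⟩ʳ i) ≉ 0#)
  invertible∧sparse⇒monomial {r} {A} (B , A⊗B≈Id , B⊗A≈Id) sparse = σ , supported , proj₂ ∘ row-nonzero
    where
    row-nonzero : ∀ i → ∃ λ j → A i j ≉ 0#
    row-nonzero i = ¬∀⟶∃¬ r _ (λ j → A i j ≈? 0#) λ row≈0 → 1≉0 (begin
      1#           ≡⟨ single-≡ i 1# ⟨
      Id i i       ≈⟨ A⊗B≈Id i i ⟨
      (A ⊗ B) i i  ≈⟨ sum-zero (λ j → trans (*-congʳ (row≈0 j)) (zeroˡ _)) ⟩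
      0#           ∎)
    column-nonzero : ∀ j → ∃ λ i → A i j ≉ 0#
    column-nonzero j = ¬∀⟶∃¬ r _ (λ i → A i j ≈? 0#) λ column≈0 → 1≉0 (begin
      1#           ≡⟨ single-≡ j 1# ⟨
      Id j j       ≈⟨ B⊗A≈Id j j ⟨
      (B ⊗ A) j j  ≈⟨ sum-zero (λ i → trans (*-congˡ (column≈0 i)) (zeroʳ _)) ⟩
      0#           ∎)
    B⊗A-column : ∀ {i k} → A i k ≉ 0# → ∀ j → (B ⊗ A) j k ≈ B j i * A i k
    B⊗A-column {i} {k} Aik≉0 j = sum-single i λ l l≢i →
      trans (*-congˡ (decidable-stable (A l k ≈? 0#) (λ Alk≉0 → l≢i (sparse Alk≉0 Aik≉0)))) (zeroʳ _)
    row-unique : ∀ {i j k} → A i j ≉ 0# → A i k ≉ 0# → j ≡ k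
    row-unique {i} {j} {k} Aij≉0 Aik≉0 with j ≟ k
    ... | yes j≡k = j≡k
    ... | no j≢k = contradiction (begin
      1#           ≡⟨ single-≡ j 1# ⟨
      Id j j       ≈⟨ B⊗A≈Id j j ⟨
      (B ⊗ A) j j  ≈⟨ B⊗A-column Aij≉0 j ⟩
      B j i * A i j ≈⟨ *-congʳ Bji≈0 ⟩
      0# * A i j   ≈⟨ zeroˡ _ ⟩
      0#           ∎) 1≉0
      where
      Bji≈0 : B j i ≈ 0#
      Bji≈0 = x≉0∧xy≈0⇒y≈0 Aik≉0 (begin
        A i k * B j i   ≈⟨ *-comm _ _ ⟩
        B j i * A i k   ≈⟨ B⊗A-column Aik≉0 j ⟨
        (B ⊗ A) j k     ≈⟨ B⊗A≈Id j k ⟩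
        Id j k          ≡⟨ single-≢ 1# j≢k ⟩
        0#              ∎)
    π τ : Fin r → Fin r
    π i = proj₁ (row-nonzero i)
    τ j = proj₁ (column-nonzero j)
    σ : Permutation′ r
    σ = permutation π τ (λ j → row-unique (proj₂ (row-nonzero (τ j))) (proj₂ (column-nonzero j)))
                        (λ i → sparse (proj₂ (column-nonzero (π i))) (proj₂ (row-nonzero i)))
    supported : SupportedOn A σ
    supported i j j≢πi = decidable-stable (A i j ≈? 0#) (λ Aij≉0 → j≢πi (row-unique Aij≉0 (proj₂ (row-nonzero i))))

  act-single : ∀ {r} (A : Matrix r) {ρ} → IsAut ρ → ∀ j u i → act A ρ (single j u) i ≈ A i j * ρ u
  act-single A {ρ} ρ-aut j u i = begin
    act A ρ (single j u) i    ≈⟨ sum-single j (λ k k≢j → trans (*-congˡ (ρ[single]≈0 (k≢j ∘ ≡.sym))) (zeroʳ _)) ⟩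
    A i j * ρ (single j u j)  ≡⟨ ≡.cong (λ x → A i j * ρ x) (single-≡ j u) ⟩
    A i j * ρ u               ∎
    where
    open Automorphism ρ-aut
    ρ[single]≈0 : ∀ {k} → j ≢ k → ρ (single j u k) ≈ 0#
    ρ[single]≈0 j≢k = trans (⟦⟧-cong (reflexive (single-≢ u j≢k))) 0#-homo

  single∈Prod : ∀ {r} {U : Fin r → Pred Carrier 0ℓ} → (∀ k → U k 0#) → ∀ {j u} → U j u → Prod U (single j u)
  single∈Prod U∋0 {j} u∈Uj k with j ≟ k
  ... | yes ≡.refl = u∈Uj
  ... | no _ = U∋0 k

  module _ {r} {A : Matrix r} {ρ} (ρ-aut : IsAut ρ) {U W : Fin r → Pred Carrier 0ℓ} where
    open Automorphism ρ-aut

    image⊆⇒column : (∀ k → IsSubspace (U k)) → (∀ k → IsSubspace (W k)) →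
                    Image A ρ (Prod U) ⊆ Prod W → ∀ i j {u} → U j u → W i (A i j * ρ u)
    image⊆⇒column U-sub W-sub image⊆ i j {u} u∈Uj = IsSubspace.resp (W-sub i) (act-single A ρ-aut j u i)
      (image⊆ (single j u , single∈Prod {U = U} (λ k → IsSubspace.has0 (U-sub k)) u∈Uj , λ _ → refl) i)

    ⊆image⇒row : (∀ k → IsSubspace (W k)) → Prod W ⊆ Image A ρ (Prod U) →
                 ∀ i {w} → W i w → ∃ λ v → Prod U v × act A ρ v i ≈ w
    ⊆image⇒row W-sub ⊆image i {w} w∈Wi with ⊆image (single∈Prod {U = W} (λ k → IsSubspace.has0 (W-sub k)) w∈Wi)
    ... | v , v∈U , Av≈w = v , v∈U , trans (Av≈w i) (reflexive (single-≡ i w))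

    supported-image⇒pivots : ∀ {σ} → SupportedOn A σ →
      (∀ k → IsSubspace (U k)) → (∀ k → IsSubspace (W k)) → Image A ρ (Prod U) ≐ Prod W →
      ∀ i → W i ≐ A i (σ ⟨$⟩ʳ i) · (U (σ ⟨$⟩ʳ i) ^[ ρ ])
    supported-image⇒pivots {σ} A-supp U-sub W-sub (image⊆ , ⊆image) i = Wi⊆ , ⊆Wi
      where
      Wi⊆ : W i ⊆ A i (σ ⟨$⟩ʳ i) · (U (σ ⟨$⟩ʳ i) ^[ ρ ])
      Wi⊆ w∈Wi with ⊆image⇒row W-sub ⊆image i w∈Wi
      ... | v , v∈U , Av≈w = ∈-·^⁺ (v∈U (σ ⟨$⟩ʳ i)) (trans (sym Av≈w) (supported-row-sum {σ = σ} A-supp i (ρ ∘ v)))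
      ⊆Wi : A i (σ ⟨$⟩ʳ i) · (U (σ ⟨$⟩ʳ i) ^[ ρ ]) ⊆ W i
      ⊆Wi z∈ with ∈-·^⁻ z∈
      ... | u , u∈U , z≈Aρu = IsSubspace.resp (W-sub i) (sym z≈Aρu) (image⊆⇒column U-sub W-sub image⊆ i _ u∈U)

    pivots⇒supported-image : ∀ {σ} → SupportedOn A σ → (∀ k → IsSubspace (W k)) →
      (∀ i → W i ≐ A i (σ ⟨$⟩ʳ i) · (U (σ ⟨$⟩ʳ i) ^[ ρ ])) → Image A ρ (Prod U) ≐ Prod W
    pivots⇒supported-image {σ} A-supp W-sub W≐ = image⊆ , ⊆image
      where
      image⊆ : Image A ρ (Prod U) ⊆ Prod W
      image⊆ (v , v∈U , Av≈w) i = IsSubspace.resp (W-sub i)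
        (trans (sym (supported-row-sum {σ = σ} A-supp i (ρ ∘ v))) (Av≈w i))
        (proj₂ (W≐ i) (∈-·^⁺ (v∈U (σ ⟨$⟩ʳ i)) refl))
      ⊆image : Prod W ⊆ Image A ρ (Prod U)
      ⊆image {w} w∈W = v , v∈U , Av≈w
        where
        preimage : ∀ i → ∃ λ u → U (σ ⟨$⟩ʳ i) u × w i ≈ A i (σ ⟨$⟩ʳ i) * ρ u
        preimage i = ∈-·^⁻ (proj₁ (W≐ i) (w∈W i))
        v : Fin r → Carrier
        v j = proj₁ (preimage (σ ⟨$⟩ˡ j))
        v∈U : Prod U v
        v∈U j = ≡.subst (λ k → U k (v j)) (inverseʳ σ) (proj₁ (proj₂ (preimage (σ ⟨$⟩ˡ j))))
        Av≈w : ∀ i → act A ρ v i ≈ w i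
        Av≈w i = begin
          act A ρ v i                                              ≈⟨ supported-row-sum {σ = σ} A-supp i (ρ ∘ v) ⟩
          A i (σ ⟨$⟩ʳ i) * ρ (proj₁ (preimage (σ ⟨$⟩ˡ (σ ⟨$⟩ʳ i)))) ≡⟨ ≡.cong (λ k → A i (σ ⟨$⟩ʳ i) * ρ (proj₁ (preimage k))) (inverseˡ σ) ⟩
          A i (σ ⟨$⟩ʳ i) * ρ (proj₁ (preimage i))                   ≈⟨ proj₂ (proj₂ (preimage i)) ⟨
          w i                                                      ∎

  related⇒equivalent : ∀ {r} {U W : Fin r → Pred Carrier 0ℓ} {σ λs ρ} →
                       (∀ k → IsSubspace (W k)) → Relates U W σ λs ρ → Equivalent U W
  related⇒equivalent {U = U} {W} {σ} {λs} {ρ} W-sub (ρ-aut , λs≉0 , W≐) =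
    monomial σ λs , ρ , monomial-invertible σ λs≉0 , ρ-aut ,
    pivots⇒supported-image ρ-aut {U = U} {σ = σ} (monomial-supported σ λs) W-sub W≐pivot
    where
    W≐pivot : ∀ i → W i ≐ monomial σ λs i (σ ⟨$⟩ʳ i) · (U (σ ⟨$⟩ʳ i) ^[ ρ ])
    W≐pivot i = ≡.subst (λ x → W i ≐ x · (U (σ ⟨$⟩ʳ i) ^[ ρ ])) (≡.sym (single-≡ (σ ⟨$⟩ʳ i) (λs i))) (W≐ i)

  related⇒dim : ∀ {r} {U W : Fin r → Pred Carrier 0ℓ} {σ λs ρ} → Relates U W σ λs ρ →
                ∀ i d → HasDim (U (σ ⟨$⟩ʳ i)) d → HasDim (W i) d
  related⇒dim (ρ-aut , λs≉0 , W≐) i d =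
    HasDim-resp-≐ (≐-sym (W≐ i)) ∘ Automorphism.semilinear-image-dim ρ-aut (λs≉0 i)

  module Subfield (1≤q : 1 ≤ q) (-1∈Fq : Fq (- 1#)) where

    Fq-0 : Fq 0#
    Fq-0 = 0^k≈0 q 1≤q
      where
      0^k≈0 : ∀ k → 1 ≤ k → 0# ^ᴿ k ≈ 0#
      0^k≈0 (suc k) _ = zeroˡ _

    Fq-‿ : ∀ {a} → Fq a → Fq (- a)
    Fq-‿ {a} a∈Fq = Fq-resp (-1*x≈-x a) (Fq-* -1∈Fq a∈Fq)

    independent₂⇒≉0 : ∀ {x y} → Independent₂ x y → x ≉ 0#
    independent₂⇒≉0 {x} {y} x⊥y x≈0 = 1≉0 (proj₁ (x⊥y 1# 0# Fq-1 Fq-0 (begin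
      1# * x + 0# * y    ≈⟨ +-cong (trans (*-identityˡ x) x≈0) (zeroˡ y) ⟩
      0# + 0#            ≈⟨ +-identityʳ 0# ⟩
      0#                 ∎)))

    dim>1⇒independent₂ : ∀ {U d} → HasDim U d → 1 ℕ.< d → ∃₂ λ x y → U x × U y × Independent₂ x y
    dim>1⇒independent₂ {d = suc zero} _ (ℕ.s≤s ())
    dim>1⇒independent₂ {U} {suc (suc d)} (b , b∈U , b-indep , _) _ =
      b zero , b (suc zero) , b∈U zero , b∈U (suc zero) ,
      λ a c a∈Fq c∈Fq rel → let a∷c∷0 = coefficients a c in
        b-indep a∷c∷0 (coefficients-∈Fq a∈Fq c∈Fq) (trans (lincomb-two a c) rel) zero ,
        b-indep a∷c∷0 (coefficients-∈Fq a∈Fq c∈Fq) (trans (lincomb-two a c) rel) (suc zero)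
      where
      coefficients : Carrier → Carrier → Fin (suc (suc d)) → Carrier
      coefficients a c zero = a
      coefficients a c (suc zero) = c
      coefficients a c (suc (suc _)) = 0#
      coefficients-∈Fq : ∀ {a c} → Fq a → Fq c → ∀ k → Fq (coefficients a c k)
      coefficients-∈Fq a∈Fq c∈Fq zero = a∈Fq
      coefficients-∈Fq a∈Fq c∈Fq (suc zero) = c∈Fq
      coefficients-∈Fq a∈Fq c∈Fq (suc (suc _)) = Fq-0
      lincomb-two : ∀ a c → lincomb (coefficients a c) b ≈ a * b zero + c * b (suc zero)
      lincomb-two a c = +-congˡ (trans (+-congˡ (sum-zero {d} (λ k → zeroˡ (b (suc (suc k)))))) (+-identityʳ _))

    dim≤1⇒¬independent₂ : ∀ {X d} → HasDim X d → d ℕ.≤ 1 → ∀ {x y} → X x → X y → ¬ Independent₂ x y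
    dim≤1⇒¬independent₂ {d = zero} (_ , _ , _ , b-span) _ x∈X _ x⊥y =
      independent₂⇒≉0 x⊥y (proj₂ (proj₂ (b-span _ x∈X)))
    dim≤1⇒¬independent₂ {d = suc (suc _)} _ (ℕ.s≤s ())
    dim≤1⇒¬independent₂ {d = suc zero} (b , _ , _ , b-span) _ {x} {y} x∈X y∈X x⊥y
      with b-span x x∈X | b-span y y∈X
    ... | a , a∈Fq , x≈ab | c , c∈Fq , y≈cb = independent₂⇒≉0 x⊥y (begin
      x              ≈⟨ x≈ab ⟩
      a zero * b zero + 0#   ≈⟨ +-identityʳ _ ⟩
      a zero * b zero        ≈⟨ *-congʳ a₀≈0 ⟩
      0# * b zero    ≈⟨ zeroˡ _ ⟩
      0#             ∎)
      where
      relation : c zero * x + - a zero * y ≈ 0#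
      relation = begin
        c zero * x + - a zero * y
          ≈⟨ +-cong (*-congˡ (trans x≈ab (+-identityʳ _))) (*-congˡ (trans y≈cb (+-identityʳ _))) ⟩
        c zero * (a zero * b zero) + - a zero * (c zero * b zero)
          ≈⟨ +-cong (x∙yz≈y∙xz _ _ _) (sym (-‿distribˡ-* _ _)) ⟩
        a zero * (c zero * b zero) + - (a zero * (c zero * b zero))
          ≈⟨ -‿inverseʳ _ ⟩
        0# ∎
      a₀≈0 : a zero ≈ 0#
      a₀≈0 = trans (sym (⁻¹-involutive _)) (trans (-‿cong (proj₂ (x⊥y _ _ (c∈Fq zero) (Fq-‿ (a∈Fq zero)) relation))) ε⁻¹≈ε)

    scattered⇒sparse : ∀ {r} {U W : Fin r → Pred Carrier 0ℓ} {A : Matrix r} {ρ} →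
                       Admissible U → Admissible W → IsAut ρ → Image A ρ (Prod U) ⊆ Prod W → ColumnSparse A
    scattered⇒sparse {U = U} {W} {A} {ρ} admU admW ρ-aut image⊆ {i} {l} {j} Aij≉0 Alj≉0 =
      decidable-stable (i ≟ l) rows-distinct-absurd
      where
      Alj⁻¹ = proj₁ (inverse (A l j) Alj≉0)
      α = A i j * Alj⁻¹
      column = image⊆⇒column ρ-aut (Admissible.subspace admU) (Admissible.subspace admW) image⊆
      Aρ[Uj]⊆X : ∀ {u} → U j u → (W i ∩ (α · W l)) (A i j * ρ u)
      Aρ[Uj]⊆X {u} u∈Uj = column i j u∈Uj , (A l j * ρ u , column l j u∈Uj , sym (begin
        α * (A l j * ρ u)                ≈⟨ *-assoc _ _ _ ⟩
        A i j * (Alj⁻¹ * (A l j * ρ u))  ≈⟨ *-congˡ (sym (*-assoc _ _ _)) ⟩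
        A i j * ((Alj⁻¹ * A l j) * ρ u)  ≈⟨ *-congˡ (*-congʳ (trans (*-comm _ _) (proj₂ (inverse (A l j) Alj≉0)))) ⟩
        A i j * (1# * ρ u)               ≈⟨ *-congˡ (*-identityˡ _) ⟩
        A i j * ρ u                      ∎))
      rows-distinct-absurd : ¬ i ≢ l
      rows-distinct-absurd i≢l with Admissible.dim>1 admU j | Admissible.scattered admW α i l i≢l
      ... | _ , 1<d , Uj-dim | _ , d′≤1 , X-dim with dim>1⇒independent₂ Uj-dim 1<d
      ... | x , y , x∈Uj , y∈Uj , x⊥y =
        dim≤1⇒¬independent₂ X-dim d′≤1 (Aρ[Uj]⊆X x∈Uj) (Aρ[Uj]⊆X y∈Uj)
          (independent₂-scale Aij≉0 (independent₂-ρ ρ-aut x⊥y))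

    equivalent⇒related : ∀ {r} {U W : Fin r → Pred Carrier 0ℓ} → Admissible U → Admissible W → Equivalent U W →
                         ∃ λ σ → ∃ λ λs → ∃ λ ρ → Relates U W σ λs ρ
    equivalent⇒related admU admW (A , ρ , A-inv , ρ-aut , image≐) =
      let σ , A-supp , pivot≉0 = invertible∧sparse⇒monomial A-inv (scattered⇒sparse admU admW ρ-aut (proj₁ image≐))
      in σ , (λ i → A i (σ ⟨$⟩ʳ i)) , ρ , ρ-aut , pivot≉0 ,
         supported-image⇒pivots ρ-aut {σ = σ} A-supp (Admissible.subspace admU) (Admissible.subspace admW) image≐

module PrimePowerField (R : CommutativeRing 0ℓ 0ℓ) {p k n : ℕ} (p-prime : Prime p)
                       (F : IsFiniteField R ((p ^ k) ^ n)) where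
  open CommutativeRing R
  open RingProperties R
  open FiniteFieldProperties R F
  open Semilinear R F (p ^ k)
  open Over R (p ^ k) using (Fq)
  open import Algebra.Properties.Group +-group using (inverseʳ-unique)

  1≤q : 1 ≤ p ^ k
  1≤q = ℕP.m^n>0 p {{prime⇒nonZero p-prime}} k

  -- For odd q this is (-1)^q = -1; for even q the characteristic is 2, so -1 = 1.
  -1∈Fq : Fq (- 1#)
  -1∈Fq with -1^≈-1⊎2∣ (p ^ k)
  ... | inj₁ -1^q≈-1 = -1^q≈-1
  ... | inj₂ 2∣q = Fq-resp 1≈-1 Fq-1
    where
    2≡p : 2 ≡ p
    2≡p = prime∣prime^⇒≡ k prime[2] p-prime 2∣q
    1+1≈0 : 1# + 1# ≈ 0#
    1+1≈0 = trans (+-congˡ (sym (+-identityʳ 1#)))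
      (size≡p^e⇒p×1≈0 2 (k ℕ.* n) (≡.trans (ℕP.^-*-assoc p k n) (≡.cong (ℕ._^ (k ℕ.* n)) (≡.sym 2≡p))))
    1≈-1 : 1# ≈ - 1#
    1≈-1 = inverseʳ-unique 1# 1# 1+1≈0

theorem4p2 : (R : CommutativeRing 0ℓ 0ℓ) (q n r : ℕ) →
    IsPrimePower q → 1 ≤ n → 1 ≤ r → IsFiniteField R (q ^ n) →
    (U W : Fin r → Pred (CommutativeRing.Carrier R) 0ℓ) →
    Over.Admissible R q U → Over.Admissible R q W →
    (Over.Equivalent R q U W ⇔
       (∃ λ (σ : Permutation′ r) → ∃ λ (λs : Fin r → CommutativeRing.Carrier R) →
          ∃ λ (ρ : CommutativeRing.Carrier R → CommutativeRing.Carrier R) →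
            Over.Relates R q U W σ λs ρ))
    × (∀ σ λs ρ → Over.Relates R q U W σ λs ρ →
         ∀ i d → Over.HasDim R q (U (σ ⟨$⟩ʳ i)) d → Over.HasDim R q (W i) d)
theorem4p2 R _ n r (p , k , p-prime , _ , ≡.refl) _ _ F U W admU admW =
  mk⇔ (equivalent⇒related admU admW)
      (λ (σ , _ , _ , rel) → related⇒equivalent {U = U} {σ = σ} (Admissible.subspace admW) rel) ,
  λ σ _ _ → related⇒dim {U = U} {σ = σ}
  where
  open PrimePowerField R {k = k} {n} p-prime F using (1≤q; -1∈Fq)
  open Semilinear R F (p ^ k)
  open Subfield 1≤q -1∈Fq
  open Over R (p ^ k) using (module Admissible)
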